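{- For all terms $t,s$ of the exponential substitution calculus, if $t\to_{\mathrm{ess}} s$ then $t\to_{\mathrm{ems}}^{+} s$ (one or more micro-step exponential steps).
   Context: Exponential substitution calculus. Variables: multiplicative $m,n,\ldots$ and exponential $e,f,g,\ldots$ (disjoint kinds); $x,y,z$ range over both. Multiplicative values $v_{\mathsf m} ::= m \mid (t,s) \mid \lambda x.t$; exponential values $v_{\mathsf e} ::= e \mid\ !t$; values $v ::= v_{\mathsf m}\mid v_{\mathsf e}$. Terms: $t,s,u ::= v \mid \mathsf{cut}(v,x.t) \mid \mathsf{par}(m,x.y.t) \mid \mathsf{sub}(m,v,x.t) \mid \mathsf{der}(e,x.t)$; $x$ (resp. $x,y$ in par) bound in $t$; terms up to $\alpha$; $\mathrm{fv}$ = free variables. Left contexts $L ::= \langle\cdot\rangle \mid \mathsf{cut}(v,x.L)\mid\mathsf{par}(m,x.y.L)\mid\mathsf{sub}(m,v,x.L)\mid\mathsf{der}(e,x.L)$; every term is uniquely $L\langle v\rangle$. Value contexts $V ::= \langle\cdot\rangle \mid (C,s)\mid (t,C)\mid\lambda x.C\mid\ !C$; general contexts $C ::= V \mid \mathsf{cut}(V,x.t)\mid\mathsf{sub}(m,V,x.t)\mid L\langle C\rangle$. Plugging $C\langle t\rangle$ replaces the hole (may capture), except that if $t=L\langle v\rangle$ then $\mathsf{cut}(\langle\cdot\rangle,x.s)\langle t\rangle := L\langle\mathsf{cut}(v,x.s)\rangle$ and $\mathsf{sub}(m,\langle\cdot\rangle,x.s)\langle t\rangle := L\langle\mathsf{sub}(m,v,x.s)\rangle$;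 $C\langle\!\langle t\rangle\!\rangle$ is capture-avoiding plugging. Meta-level substitution $\{v_{\mathsf e}/e\}t$ (capture-avoiding) commutes with all constructors, is identity on variables other than $e$, $\{v_{\mathsf e}/e\}e := v_{\mathsf e}$, and $\{f/e\}\mathsf{der}(e,x.t) := \mathsf{der}(f,x.\{f/e\}t)$, $\{!L\langle v\rangle/e\}\mathsf{der}(e,x.t) := L\langle \mathsf{cut}(v,x.\{!L\langle v\rangle/e\}t)\rangle$. Exponential root rules (the context $C$ does not capture $e$): (ax$_{e1}$) $\mathsf{cut}(v_{\mathsf e},e.C\langle\!\langle e\rangle\!\rangle)\mapsto\mathsf{cut}(v_{\mathsf e},e.C\langle\!\langle v_{\mathsf e}\rangle\!\rangle)$; (ax$_{e2}$) $\mathsf{cut}(f,e.C\langle\mathsf{der}(e,x.t)\rangle)\mapsto\mathsf{cut}(f,e.C\langle\mathsf{der}(f,x.t)\rangle)$; (!der) $\mathsf{cut}(!s,e.C\langle\mathsf{der}(e,x.t)\rangle)\mapsto\mathsf{cut}(!s,e.C\langle L\langle\mathsf{cut}(v,x.t)\rangle\rangle)$ where $s=L\langle v\rangle$; (w) $\mathsf{cut}(v_{\mathsf e},e.t)\mapsto t$ if $e\notin\mathrm{fv}(t)$; (ess) $\mathsf{cut}(v_{\mathsf e},e.t)\mapsto\{v_{\mathsf e}/e\}t$. Each root rule is closed under general contexts. $\to_{\mathrm{ems}} := \to_{ax_{e1}}\cup\to_{ax_{e2}}\cup\to_{!der}\cup\to_w$. -}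

module Defs where

open import Data.List using (List; []; _∷_)
open import Data.Sum using (_⊎_)
open import Relation.Binary.Construct.Closure.Transitive using (TransClosure)

-- Syntax: intrinsically scoped (de Bruijn) terms, so alpha-equivalence
-- is syntactic identity.  Each bound variable carries its kind.

data Kind : Set where
  𝕞 𝕖 : Kind        -- multiplicative / exponential

Ctx : Set
Ctx = List Kind

data _∋_ : Ctx → Kind → Set where
  here  : ∀ {Γ k} → (k ∷ Γ) ∋ k
  there : ∀ {Γ j k} → Γ ∋ k → (j ∷ Γ) ∋ k

mutual
  data Val (Γ : Ctx) : Kind → Set where
    mvar : Γ ∋ 𝕞 → Val Γ 𝕞
    pair : Tm Γ → Tm Γ → Val Γ 𝕞
    lam  : (k : Kind) → Tm (k ∷ Γ) → Val Γ 𝕞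
    evar : Γ ∋ 𝕖 → Val Γ 𝕖
    bang : Tm Γ → Val Γ 𝕖

  data Tm (Γ : Ctx) : Set where
    val : ∀ {j} → Val Γ j → Tm Γ
    cut : ∀ {j} → Val Γ j → (k : Kind) → Tm (k ∷ Γ) → Tm Γ
    par : Γ ∋ 𝕞 → (k₁ k₂ : Kind) → Tm (k₂ ∷ k₁ ∷ Γ) → Tm Γ
    sub : ∀ {j} → Γ ∋ 𝕞 → Val Γ j → (k : Kind) → Tm (k ∷ Γ) → Tm Γ
    der : Γ ∋ 𝕖 → (k : Kind) → Tm (k ∷ Γ) → Tm Γ

Ren : Ctx → Ctx → Set
Ren Γ Δ = ∀ {k} → Γ ∋ k → Δ ∋ k

liftR : ∀ {Γ Δ k} → Ren Γ Δ → Ren (k ∷ Γ) (k ∷ Δ)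
liftR ρ here      = here
liftR ρ (there x) = there (ρ x)

mutual
  renV : ∀ {Γ Δ k} → Ren Γ Δ → Val Γ k → Val Δ k
  renV ρ (mvar m)   = mvar (ρ m)
  renV ρ (pair t s) = pair (renT ρ t) (renT ρ s)
  renV ρ (lam k t)  = lam k (renT (liftR ρ) t)
  renV ρ (evar e)   = evar (ρ e)
  renV ρ (bang t)   = bang (renT ρ t)

  renT : ∀ {Γ Δ} → Ren Γ Δ → Tm Γ → Tm Δ
  renT ρ (val v)          = val (renV ρ v)
  renT ρ (cut v k t)      = cut (renV ρ v) k (renT (liftR ρ) t)
  renT ρ (par m k₁ k₂ t)  = par (ρ m) k₁ k₂ (renT (liftR (liftR ρ)) t)
  renT ρ (sub m v k t)    = sub (ρ m) (renV ρ v) k (renT (liftR ρ) t)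
  renT ρ (der e k t)      = der (ρ e) k (renT (liftR ρ) t)

wk : ∀ {Γ k} → Ren Γ (k ∷ Γ)
wk = there

-- Left contexts L (outer scope Γ, hole scope Δ)

data LCtx (Γ : Ctx) : Ctx → Set where
  hole : LCtx Γ Γ
  cut  : ∀ {j Δ} → Val Γ j → (k : Kind) → LCtx (k ∷ Γ) Δ → LCtx Γ Δ
  par  : ∀ {Δ} → Γ ∋ 𝕞 → (k₁ k₂ : Kind) → LCtx (k₂ ∷ k₁ ∷ Γ) Δ → LCtx Γ Δ
  sub  : ∀ {j Δ} → Γ ∋ 𝕞 → Val Γ j → (k : Kind) → LCtx (k ∷ Γ) Δ → LCtx Γ Δ
  der  : ∀ {Δ} → Γ ∋ 𝕖 → (k : Kind) → LCtx (k ∷ Γ) Δ → LCtx Γ Δ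

plugL : ∀ {Γ Δ} → LCtx Γ Δ → Tm Δ → Tm Γ
plugL hole            u = u
plugL (cut v k L)     u = cut v k (plugL L u)
plugL (par m k₁ k₂ L) u = par m k₁ k₂ (plugL L u)
plugL (sub m v k L)   u = sub m v k (plugL L u)
plugL (der e k L)     u = der e k (plugL L u)

embL : ∀ {Γ Δ} → LCtx Γ Δ → Ren Γ Δ
embL hole            x = x
embL (cut v k L)     x = embL L (there x)
embL (par m k₁ k₂ L) x = embL L (there (there x))
embL (sub m v k L)   x = embL L (there x)
embL (der e k L)     x = embL L (there x)

record Decomp (Γ : Ctx) : Set where
  constructor decomp⟨_,_⟩
  field
    {hscope} : Ctx
    {vkind}  : Kind
    lctx     : LCtx Γ hscope
    value    : Val hscope vkind

decomp : ∀ {Γ} → Tm Γ → Decomp Γ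
decomp (val v) = decomp⟨ hole , v ⟩
decomp (cut v k t) with decomp t
... | decomp⟨ L , w ⟩ = decomp⟨ cut v k L , w ⟩
decomp (par m k₁ k₂ t) with decomp t
... | decomp⟨ L , w ⟩ = decomp⟨ par m k₁ k₂ L , w ⟩
decomp (sub m v k t) with decomp t
... | decomp⟨ L , w ⟩ = decomp⟨ sub m v k L , w ⟩
decomp (der e k t) with decomp t
... | decomp⟨ L , w ⟩ = decomp⟨ der e k L , w ⟩

-- cutL s x t  :=  L⟨cut(v, x.t)⟩  where s = L⟨v⟩
-- (t is weakened past the binders of L: Barendregt convention)
cutL : ∀ {Γ} → Tm Γ → (k : Kind) → Tm (k ∷ Γ) → Tm Γ
cutL s k t with decomp s
... | decomp⟨ L , v ⟩ = plugL L (cut v k (renT (liftR (embL L)) t))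

-- The hole value context ⟨·⟩ is the
-- constructor 'hole' of GCtx; 'cutH'/'subH' are cut(⟨·⟩,x.t), sub(m,⟨·⟩,x.t).

mutual
  data VCtx (Γ : Ctx) : Kind → Ctx → Set where
    pairL : ∀ {Δ} → GCtx Γ Δ → Tm Γ → VCtx Γ 𝕞 Δ
    pairR : ∀ {Δ} → Tm Γ → GCtx Γ Δ → VCtx Γ 𝕞 Δ
    lam   : ∀ {Δ} → (k : Kind) → GCtx (k ∷ Γ) Δ → VCtx Γ 𝕞 Δ
    bang  : ∀ {Δ} → GCtx Γ Δ → VCtx Γ 𝕖 Δ

  data GCtx (Γ : Ctx) : Ctx → Set where
    hole : GCtx Γ Γ
    val  : ∀ {j Δ} → VCtx Γ j Δ → GCtx Γ Δ
    cutH : (k : Kind) → Tm (k ∷ Γ) → GCtx Γ Γ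
    cutV : ∀ {j Δ} → VCtx Γ j Δ → (k : Kind) → Tm (k ∷ Γ) → GCtx Γ Δ
    subH : Γ ∋ 𝕞 → (k : Kind) → Tm (k ∷ Γ) → GCtx Γ Γ
    subV : ∀ {j Δ} → Γ ∋ 𝕞 → VCtx Γ j Δ → (k : Kind) → Tm (k ∷ Γ) → GCtx Γ Δ
    -- L⟨C⟩, by one left-context layer at a time
    cutC : ∀ {j Δ} → Val Γ j → (k : Kind) → GCtx (k ∷ Γ) Δ → GCtx Γ Δ
    parC : ∀ {Δ} → Γ ∋ 𝕞 → (k₁ k₂ : Kind) → GCtx (k₂ ∷ k₁ ∷ Γ) Δ → GCtx Γ Δ
    subC : ∀ {j Δ} → Γ ∋ 𝕞 → Val Γ j → (k : Kind) → GCtx (k ∷ Γ) Δ → GCtx Γ Δ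
    derC : ∀ {Δ} → Γ ∋ 𝕖 → (k : Kind) → GCtx (k ∷ Γ) Δ → GCtx Γ Δ

mutual
  -- C⟨t⟩ (may capture)
  plugV : ∀ {Γ j Δ} → VCtx Γ j Δ → Tm Δ → Val Γ j
  plugV (pairL C s) u = pair (plug C u) s
  plugV (pairR t C) u = pair t (plug C u)
  plugV (lam k C)   u = lam k (plug C u)
  plugV (bang C)    u = bang (plug C u)

  plug : ∀ {Γ Δ} → GCtx Γ Δ → Tm Δ → Tm Γ
  plug hole              u = u
  plug (val V)           u = val (plugV V u)
  plug (cutH k t)        u = cutL u k t
  plug (cutV V k t)      u = cut (plugV V u) k t
  plug (subH m k t)      u with decomp u
  ... | decomp⟨ L , v ⟩ = plugL L (sub (embL L m) v k (renT (liftR (embL L)) t))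
  plug (subV m V k t)    u = sub m (plugV V u) k t
  plug (cutC v k C)      u = cut v k (plug C u)
  plug (parC m k₁ k₂ C)  u = par m k₁ k₂ (plug C u)
  plug (subC m v k C)    u = sub m v k (plug C u)
  plug (derC e k C)      u = der e k (plug C u)

mutual
  embV : ∀ {Γ j Δ} → VCtx Γ j Δ → Ren Γ Δ
  embV (pairL C s) x = emb C x
  embV (pairR t C) x = emb C x
  embV (lam k C)   x = emb C (there x)
  embV (bang C)    x = emb C x

  -- embedding of the outer scope into the hole scope
  -- (a variable emb C x is one that C does not capture)
  emb : ∀ {Γ Δ} → GCtx Γ Δ → Ren Γ Δ
  emb hole             x = x
  emb (val V)          x = embV V x
  emb (cutH k t)       x = x
  emb (cutV V k t)     x = embV V x
  emb (subH m k t)     x = x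
  emb (subV m V k t)   x = embV V x
  emb (cutC v k C)     x = emb C (there x)
  emb (parC m k₁ k₂ C) x = emb C (there (there x))
  emb (subC m v k C)   x = emb C (there x)
  emb (derC e k C)     x = emb C (there x)

-- capture-avoiding plugging C⟨⟨t⟩⟩ (t lives in the outer scope)
-- (helper: plug C (renT (emb C) t) is C⟨⟨t⟩⟩)
plug⟪_⟫ : ∀ {Γ Δ} → GCtx Γ Δ → Tm Γ → Tm Γ
plug⟪ C ⟫ t = plug C (renT (emb C) t)

Img : Ctx → Kind → Set
Img Δ 𝕞 = Δ ∋ 𝕞
Img Δ 𝕖 = Val Δ 𝕖

Sub : Ctx → Ctx → Set
Sub Γ Δ = ∀ {k} → Γ ∋ k → Img Δ k

wkImg : ∀ {Δ j} k → Img Δ k → Img (j ∷ Δ) k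
wkImg 𝕞 x = there x
wkImg 𝕖 v = renV there v

liftS : ∀ {Γ Δ j} → Sub Γ Δ → Sub (j ∷ Γ) (j ∷ Δ)
liftS {j = 𝕞} σ here = here
liftS {j = 𝕖} σ here = evar here
liftS σ {k} (there x) = wkImg k (σ x)

-- {v_e/e} der(e,x.t) for the image v_e of the dereliction variable
derS : ∀ {Δ} → Val Δ 𝕖 → (k : Kind) → Tm (k ∷ Δ) → Tm Δ
derS (evar f) k t = der f k t
derS (bang s) k t = cutL s k t

mutual
  subVal : ∀ {Γ Δ k} → Sub Γ Δ → Val Γ k → Val Δ k
  subVal σ (mvar m)   = mvar (σ m)
  subVal σ (pair t s) = pair (subTm σ t) (subTm σ s)
  subVal σ (lam k t)  = lam k (subTm (liftS σ) t)
  subVal σ (evar e)   = σ e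
  subVal σ (bang t)   = bang (subTm σ t)

  subTm : ∀ {Γ Δ} → Sub Γ Δ → Tm Γ → Tm Δ
  subTm σ (val v)         = val (subVal σ v)
  subTm σ (cut v k t)     = cut (subVal σ v) k (subTm (liftS σ) t)
  subTm σ (par m k₁ k₂ t) = par (σ m) k₁ k₂ (subTm (liftS (liftS σ)) t)
  subTm σ (sub m v k t)   = sub (σ m) (subVal σ v) k (subTm (liftS σ) t)
  subTm σ (der e k t)     = derS (σ e) k (subTm (liftS σ) t)

single : ∀ {Γ} → Val Γ 𝕖 → Sub (𝕖 ∷ Γ) Γ
single v here              = v
single v {𝕞} (there x) = x
single v {𝕖} (there x) = evar x

_[_/e] : ∀ {Γ} → Tm (𝕖 ∷ Γ) → Val Γ 𝕖 → Tm Γ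
t [ v /e] = subTm (single v) t

-- Root rules.  In each rule the bound variable e is the outermost
-- variable 'here' of the body's scope; "C does not capture e" means the
-- occurrence is  emb C here.

data AxE1 {Γ : Ctx} : Tm Γ → Tm Γ → Set where
  axe1 : ∀ {Δ} (ve : Val Γ 𝕖) (C : GCtx (𝕖 ∷ Γ) Δ) →
         AxE1 (cut ve 𝕖 (plug⟪ C ⟫ (val (evar here))))
              (cut ve 𝕖 (plug⟪ C ⟫ (val (renV wk ve))))

data AxE2 {Γ : Ctx} : Tm Γ → Tm Γ → Set where
  axe2 : ∀ {Δ} (f : Γ ∋ 𝕖) (C : GCtx (𝕖 ∷ Γ) Δ) (k : Kind) (t : Tm (k ∷ Δ)) →
         AxE2 (cut (evar f) 𝕖 (plug C (der (emb C here) k t)))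
              (cut (evar f) 𝕖 (plug C (der (emb C (there f)) k t)))

-- (!der): s = L⟨v⟩, and C⟨L⟨cut(v,x.t)⟩⟩ = C⟨cutL s' x t⟩ with s' the copy of
-- s inside C (its free variables are not captured by C).
data BangDer {Γ : Ctx} : Tm Γ → Tm Γ → Set where
  bangder : ∀ {Δ} (s : Tm Γ) (C : GCtx (𝕖 ∷ Γ) Δ) (k : Kind) (t : Tm (k ∷ Δ)) →
            BangDer (cut (bang s) 𝕖 (plug C (der (emb C here) k t)))
                    (cut (bang s) 𝕖 (plug C (cutL (renT (λ x → emb C (there x)) s) k t)))

-- (w): e ∉ fv(t) means t is the weakening of a term t' of the outer scope
data W {Γ : Ctx} : Tm Γ → Tm Γ → Set where
  weak : (ve : Val Γ 𝕖) (t : Tm Γ) → W (cut ve 𝕖 (renT wk t)) t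

data Ess {Γ : Ctx} : Tm Γ → Tm Γ → Set where
  ess : (ve : Val Γ 𝕖) (t : Tm (𝕖 ∷ Γ)) → Ess (cut ve 𝕖 t) (t [ ve /e])

RootRel : Set₁
RootRel = ∀ {Γ} → Tm Γ → Tm Γ → Set

data Step (R : RootRel) {Γ : Ctx} : Tm Γ → Tm Γ → Set where
  ctx : ∀ {Δ} (C : GCtx Γ Δ) {t s : Tm Δ} → R t s → Step R (plug C t) (plug C s)

_→ess_ : ∀ {Γ} → Tm Γ → Tm Γ → Set
t →ess s = Step Ess t s

_→ems_ : ∀ {Γ} → Tm Γ → Tm Γ → Set
t →ems s = Step AxE1 t s ⊎ Step AxE2 t s ⊎ Step BangDer t s ⊎ Step W t s

_→ems⁺_ : ∀ {Γ} → Tm Γ → Tm Γ → Set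
_→ems⁺_ {Γ} = TransClosure (_→ems_ {Γ})

-- An (ess) step contracts cut(v_e, e.t) to {v_e/e}t in one go. The micro-step rules perform the
-- same substitution one occurrence of e at a time, left to right: a value occurrence of e is
-- replaced by v_e (ax_e1), an occurrence der(e,x.u) becomes der(f,x.u) if v_e = f (ax_e2), or
-- L⟨cut(v,x.u)⟩ if v_e = !L⟨v⟩ (!der), which is exactly the clause of {v_e/e} for dereliction.
-- Once no occurrence is left, the cut is erased by (w).
module Submission where

open import Defs
open import Data.List using (_∷_)
open import Data.Sum as Sum using (_⊎_; inj₁; inj₂)
open import Data.Product using (_×_; _,_; ∃-syntax)
open import Relation.Binary.PropositionalEquality
open import Relation.Binary.Construct.Closure.ReflexiveTransitive using (Star; ε; _◅_; _◅◅_)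
open import Relation.Binary.Construct.Closure.Transitive using (TransClosure; [_]; _∷_)
open Decomp
open ≡-Reasoning

infix 4 _≗ʳ_

_≗ʳ_ : ∀ {Γ Δ} → Ren Γ Δ → Ren Γ Δ → Set
f ≗ʳ g = ∀ {k} x → f {k} x ≡ g x

liftR-fusion : ∀ {Γ Δ Ξ j} {f : Ren Δ Ξ} {g : Ren Γ Δ} {h : Ren Γ Ξ} →
               (λ x → f (g x)) ≗ʳ h → (λ x → liftR {k = j} f (liftR g x)) ≗ʳ liftR h
liftR-fusion p here      = refl
liftR-fusion p (there x) = cong there (p x)

liftR-identity : ∀ {Γ j} {f : Ren Γ Γ} → f ≗ʳ (λ x → x) → liftR {k = j} f ≗ʳ (λ x → x)
liftR-identity p here      = refl
liftR-identity p (there x) = cong there (p x)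

liftR-square : ∀ {Γ Δ Δ′ Ξ j} {f : Ren Δ Ξ} {g : Ren Γ Δ} {f′ : Ren Δ′ Ξ} {g′ : Ren Γ Δ′} →
               (λ x → f (g x)) ≗ʳ (λ x → f′ (g′ x)) →
               (λ x → liftR {k = j} f (liftR g x)) ≗ʳ (λ x → liftR f′ (liftR g′ x))
liftR-square p here      = refl
liftR-square p (there x) = cong there (p x)

mutual
  renV-fusion : ∀ {Γ Δ Ξ k} {f : Ren Δ Ξ} {g : Ren Γ Δ} {h : Ren Γ Ξ} →
                (λ x → f (g x)) ≗ʳ h → (v : Val Γ k) → renV f (renV g v) ≡ renV h v
  renV-fusion p (mvar m)   = cong mvar (p m)
  renV-fusion p (pair t s) = cong₂ pair (renT-fusion p t) (renT-fusion p s)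
  renV-fusion p (lam k t)  = cong (lam k) (renT-fusion (liftR-fusion p) t)
  renV-fusion p (evar e)   = cong evar (p e)
  renV-fusion p (bang t)   = cong bang (renT-fusion p t)

  renT-fusion : ∀ {Γ Δ Ξ} {f : Ren Δ Ξ} {g : Ren Γ Δ} {h : Ren Γ Ξ} →
                (λ x → f (g x)) ≗ʳ h → (t : Tm Γ) → renT f (renT g t) ≡ renT h t
  renT-fusion p (val v)         = cong val (renV-fusion p v)
  renT-fusion p (cut v k t)     =
    cong₂ (λ w u → cut w k u) (renV-fusion p v) (renT-fusion (liftR-fusion p) t)
  renT-fusion p (par m k₁ k₂ t) =
    cong₂ (λ n u → par n k₁ k₂ u) (p m) (renT-fusion (liftR-fusion (liftR-fusion p)) t)
  renT-fusion {f = f} {g} {h} p (sub m v k t) =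
    trans (cong (λ n → sub n (renV f (renV g v)) k (renT (liftR f) (renT (liftR g) t))) (p m))
          (cong₂ (λ w u → sub (h m) w k u) (renV-fusion p v) (renT-fusion (liftR-fusion p) t))
  renT-fusion p (der e k t)     = cong₂ (λ f u → der f k u) (p e) (renT-fusion (liftR-fusion p) t)

mutual
  renV-identity : ∀ {Γ k} {f : Ren Γ Γ} → f ≗ʳ (λ x → x) → (v : Val Γ k) → renV f v ≡ v
  renV-identity p (mvar m)   = cong mvar (p m)
  renV-identity p (pair t s) = cong₂ pair (renT-identity p t) (renT-identity p s)
  renV-identity p (lam k t)  = cong (lam k) (renT-identity (liftR-identity p) t)
  renV-identity p (evar e)   = cong evar (p e)
  renV-identity p (bang t)   = cong bang (renT-identity p t)

  renT-identity : ∀ {Γ} {f : Ren Γ Γ} → f ≗ʳ (λ x → x) → (t : Tm Γ) → renT f t ≡ t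
  renT-identity p (val v)         = cong val (renV-identity p v)
  renT-identity p (cut v k t)     =
    cong₂ (λ w u → cut w k u) (renV-identity p v) (renT-identity (liftR-identity p) t)
  renT-identity p (par m k₁ k₂ t) =
    cong₂ (λ n u → par n k₁ k₂ u) (p m) (renT-identity (liftR-identity (liftR-identity p)) t)
  renT-identity {f = f} p (sub m v k t) =
    trans (cong (λ n → sub n (renV f v) k (renT (liftR f) t)) (p m))
          (cong₂ (λ w u → sub m w k u) (renV-identity p v) (renT-identity (liftR-identity p) t))
  renT-identity p (der e k t)     = cong₂ (λ f u → der f k u) (p e) (renT-identity (liftR-identity p) t)

renV-id : ∀ {Γ k} (v : Val Γ k) → renV (λ x → x) v ≡ v
renV-id = renV-identity (λ _ → refl)

renT-id : ∀ {Γ} (t : Tm Γ) → renT (λ x → x) t ≡ t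
renT-id = renT-identity (λ _ → refl)

renT-cong : ∀ {Γ Δ} {f g : Ren Γ Δ} → f ≗ʳ g → (t : Tm Γ) → renT f t ≡ renT g t
renT-cong {f = f} p t = trans (cong (renT f) (sym (renT-id t))) (renT-fusion p t)

renV-square : ∀ {Γ Δ Δ′ Ξ k} {f : Ren Δ Ξ} {g : Ren Γ Δ} {f′ : Ren Δ′ Ξ} {g′ : Ren Γ Δ′} →
              (λ x → f (g x)) ≗ʳ (λ x → f′ (g′ x)) →
              (v : Val Γ k) → renV f (renV g v) ≡ renV f′ (renV g′ v)
renV-square p v = trans (renV-fusion p v) (sym (renV-fusion (λ _ → refl) v))

renT-square : ∀ {Γ Δ Δ′ Ξ} {f : Ren Δ Ξ} {g : Ren Γ Δ} {f′ : Ren Δ′ Ξ} {g′ : Ren Γ Δ′} →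
              (λ x → f (g x)) ≗ʳ (λ x → f′ (g′ x)) →
              (t : Tm Γ) → renT f (renT g t) ≡ renT f′ (renT g′ t)
renT-square p t = trans (renT-fusion p t) (sym (renT-fusion (λ _ → refl) t))

cutL-renT : ∀ {Γ Δ} (s : Tm Δ) k (ρ : Ren Γ Δ) (u : Tm (k ∷ Γ)) →
            cutL s k (renT (liftR ρ) u)
            ≡ plugL (lctx (decomp s))
                    (cut (value (decomp s)) k (renT (liftR (λ x → embL (lctx (decomp s)) (ρ x))) u))
cutL-renT s k ρ u = cong (λ u′ → plugL (lctx (decomp s)) (cut (value (decomp s)) k u′))
                         (renT-fusion (liftR-fusion (λ _ → refl)) u)

cutL-val : ∀ {Γ j} (v : Val Γ j) k (u : Tm (k ∷ Γ)) → cutL (val v) k u ≡ cut v k u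
cutL-val v k u = cong (cut v k) (renT-identity (liftR-identity (λ _ → refl)) u)

cutL-cut : ∀ {Γ j} (w : Val Γ j) j′ (s : Tm (j′ ∷ Γ)) k (u : Tm (k ∷ Γ)) →
           cutL (cut w j′ s) k u ≡ cut w j′ (cutL s k (renT (liftR there) u))
cutL-cut w j′ s k u = cong (cut w j′) (sym (cutL-renT s k there u))

cutL-par : ∀ {Γ} m k₁ k₂ (s : Tm (k₂ ∷ k₁ ∷ Γ)) k (u : Tm (k ∷ Γ)) →
           cutL (par m k₁ k₂ s) k u ≡ par m k₁ k₂ (cutL s k (renT (liftR (λ x → there (there x))) u))
cutL-par m k₁ k₂ s k u = cong (par m k₁ k₂) (sym (cutL-renT s k (λ x → there (there x)) u))

cutL-sub : ∀ {Γ j} m (w : Val Γ j) j′ (s : Tm (j′ ∷ Γ)) k (u : Tm (k ∷ Γ)) →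
           cutL (sub m w j′ s) k u ≡ sub m w j′ (cutL s k (renT (liftR there) u))
cutL-sub m w j′ s k u = cong (sub m w j′) (sym (cutL-renT s k there u))

cutL-der : ∀ {Γ} e j′ (s : Tm (j′ ∷ Γ)) k (u : Tm (k ∷ Γ)) →
           cutL (der e j′ s) k u ≡ der e j′ (cutL s k (renT (liftR there) u))
cutL-der e j′ s k u = cong (der e j′) (sym (cutL-renT s k there u))

mutual
  renT-cutL : ∀ {Γ Δ} (ρ : Ren Γ Δ) (s : Tm Γ) k (u : Tm (k ∷ Γ)) →
              renT ρ (cutL s k u) ≡ cutL (renT ρ s) k (renT (liftR ρ) u)
  renT-cutL ρ (val v) k u = cong (cut (renV ρ v) k) (renT-square (liftR-square (λ _ → refl)) u)
  renT-cutL ρ (cut w j s) k u =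
    trans (cong (renT ρ) (cutL-cut w j s k u))
          (trans (cong (cut (renV ρ w) j) (renT-cutL-under (liftR ρ) (λ _ → refl) s k u))
                 (sym (cutL-cut (renV ρ w) j (renT (liftR ρ) s) k (renT (liftR ρ) u))))
  renT-cutL ρ (par m k₁ k₂ s) k u =
    trans (cong (renT ρ) (cutL-par m k₁ k₂ s k u))
          (trans (cong (par (ρ m) k₁ k₂) (renT-cutL-under (liftR (liftR ρ)) (λ _ → refl) s k u))
                 (sym (cutL-par (ρ m) k₁ k₂ (renT (liftR (liftR ρ)) s) k (renT (liftR ρ) u))))
  renT-cutL ρ (sub m w j s) k u =
    trans (cong (renT ρ) (cutL-sub m w j s k u))
          (trans (cong (sub (ρ m) (renV ρ w) j) (renT-cutL-under (liftR ρ) (λ _ → refl) s k u))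
                 (sym (cutL-sub (ρ m) (renV ρ w) j (renT (liftR ρ) s) k (renT (liftR ρ) u))))
  renT-cutL ρ (der e j s) k u =
    trans (cong (renT ρ) (cutL-der e j s k u))
          (trans (cong (der (ρ e) j) (renT-cutL-under (liftR ρ) (λ _ → refl) s k u))
                 (sym (cutL-der (ρ e) j (renT (liftR ρ) s) k (renT (liftR ρ) u))))

  renT-cutL-under : ∀ {Γ Δ Ξ Ξ′} {ρ : Ren Γ Δ} {w : Ren Γ Ξ} {w′ : Ren Δ Ξ′} (ρ′ : Ren Ξ Ξ′) →
                    (λ x → ρ′ (w x)) ≗ʳ (λ x → w′ (ρ x)) → ∀ (s : Tm Ξ) k (u : Tm (k ∷ Γ)) →
                    renT ρ′ (cutL s k (renT (liftR w) u))
                    ≡ cutL (renT ρ′ s) k (renT (liftR w′) (renT (liftR ρ) u))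
  renT-cutL-under ρ′ sq s k u =
    trans (renT-cutL ρ′ s k _) (cong (cutL (renT ρ′ s) k) (renT-square (liftR-square sq) u))

-- Plugging general contexts is not compositional (cut(⟨·⟩,x.s) re-associates the left context of
-- what it receives), so the surroundings of a subterm are kept as context-valued functions that are.
record Frame (Γ Δ : Ctx) : Set where
  field
    fill      : ∀ {Ξ} → GCtx Δ Ξ → GCtx Γ Ξ
    plug-fill : ∀ {Ξ} (D : GCtx Δ Ξ) (u : Tm Ξ) → plug (fill D) u ≡ plug (fill hole) (plug D u)
    emb-fill  : ∀ {Ξ} (D : GCtx Δ Ξ) {k} (x : Γ ∋ k) → emb (fill D) x ≡ emb D (emb (fill hole) x)
open Frame

infix 8 _⟦_⟧

_⟦_⟧ : ∀ {Γ Δ} → Frame Γ Δ → Tm Δ → Tm Γ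
F ⟦ u ⟧ = plug (fill F hole) u

embF : ∀ {Γ Δ} → Frame Γ Δ → Ren Γ Δ
embF F = emb (fill F hole)

idF : ∀ {Γ} → Frame Γ Γ
idF = record { fill = λ D → D ; plug-fill = λ _ _ → refl ; emb-fill = λ _ _ → refl }

infixl 7 _∘F_

_∘F_ : ∀ {Γ Δ Ξ} → Frame Γ Δ → Frame Δ Ξ → Frame Γ Ξ
K ∘F F = record
  { fill      = λ D → fill K (fill F D)
  ; plug-fill = λ D u → begin
      plug (fill K (fill F D)) u              ≡⟨ plug-fill K (fill F D) u ⟩
      K ⟦ plug (fill F D) u ⟧                 ≡⟨ cong (K ⟦_⟧) (plug-fill F D u) ⟩
      K ⟦ F ⟦ plug D u ⟧ ⟧                    ≡⟨ plug-fill K (fill F hole) (plug D u) ⟨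
      plug (fill K (fill F hole)) (plug D u)  ∎
  ; emb-fill  = λ D x → begin
      emb (fill K (fill F D)) x               ≡⟨ emb-fill K (fill F D) x ⟩
      emb (fill F D) (embF K x)               ≡⟨ emb-fill F D (embF K x) ⟩
      emb D (embF F (embF K x))               ≡⟨ cong (emb D) (emb-fill K (fill F hole) x) ⟨
      emb D (emb (fill K (fill F hole)) x)    ∎
  }

⟦⟧-∘F : ∀ {Γ Δ Ξ} (K : Frame Γ Δ) (F : Frame Δ Ξ) (u : Tm Ξ) → (K ∘F F) ⟦ u ⟧ ≡ K ⟦ F ⟦ u ⟧ ⟧
⟦⟧-∘F K F = plug-fill K (fill F hole)

embF-∘F : ∀ {Γ Δ Ξ} (K : Frame Γ Δ) (F : Frame Δ Ξ) → embF (K ∘F F) ≗ʳ (λ x → embF F (embF K x))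
embF-∘F K F = emb-fill K (fill F hole)

inLCtx : ∀ {Δ Δ₁ Ξ} → LCtx Δ Δ₁ → GCtx Δ₁ Ξ → GCtx Δ Ξ
inLCtx hole            D = D
inLCtx (cut v k L)     D = cutC v k (inLCtx L D)
inLCtx (par m k₁ k₂ L) D = parC m k₁ k₂ (inLCtx L D)
inLCtx (sub m v k L)   D = subC m v k (inLCtx L D)
inLCtx (der e k L)     D = derC e k (inLCtx L D)

plug-inLCtx : ∀ {Δ Δ₁ Ξ} (L : LCtx Δ Δ₁) (D : GCtx Δ₁ Ξ) (u : Tm Ξ) →
              plug (inLCtx L D) u ≡ plugL L (plug D u)
plug-inLCtx hole            D u = refl
plug-inLCtx (cut v k L)     D u = cong (cut v k) (plug-inLCtx L D u)
plug-inLCtx (par m k₁ k₂ L) D u = cong (par m k₁ k₂) (plug-inLCtx L D u)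
plug-inLCtx (sub m v k L)   D u = cong (sub m v k) (plug-inLCtx L D u)
plug-inLCtx (der e k L)     D u = cong (der e k) (plug-inLCtx L D u)

emb-inLCtx : ∀ {Δ Δ₁ Ξ} (L : LCtx Δ Δ₁) (D : GCtx Δ₁ Ξ) → emb (inLCtx L D) ≗ʳ (λ x → emb D (embL L x))
emb-inLCtx hole            D x = refl
emb-inLCtx (cut v k L)     D x = emb-inLCtx L D (there x)
emb-inLCtx (par m k₁ k₂ L) D x = emb-inLCtx L D (there (there x))
emb-inLCtx (sub m v k L)   D x = emb-inLCtx L D (there x)
emb-inLCtx (der e k L)     D x = emb-inLCtx L D (there x)

lctxF : ∀ {Δ Δ₁} → LCtx Δ Δ₁ → Frame Δ Δ₁
lctxF L = record
  { fill      = inLCtx L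
  ; plug-fill = λ D u → trans (plug-inLCtx L D u) (sym (plug-inLCtx L hole (plug D u)))
  ; emb-fill  = λ D x → trans (emb-inLCtx L D x) (cong (emb D) (sym (emb-inLCtx L hole x)))
  }

lctxF-⟦⟧ : ∀ {Δ Δ₁} (L : LCtx Δ Δ₁) (u : Tm Δ₁) → lctxF L ⟦ u ⟧ ≡ plugL L u
lctxF-⟦⟧ L = plug-inLCtx L hole

embF-lctxF : ∀ {Δ Δ₁} (L : LCtx Δ Δ₁) → embF (lctxF L) ≗ʳ embL L
embF-lctxF L = emb-inLCtx L hole

data ValPos (Δ : Ctx) : Set where
  as-term  : ValPos Δ
  cut-head : (k : Kind) → Tm (k ∷ Δ) → ValPos Δ
  sub-head : Δ ∋ 𝕞 → (k : Kind) → Tm (k ∷ Δ) → ValPos Δ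

place : ∀ {Δ j} → ValPos Δ → Val Δ j → Tm Δ
place as-term          w = val w
place (cut-head k u)   w = cut w k u
place (sub-head m k u) w = sub m w k u

placeH : ∀ {Δ} → ValPos Δ → GCtx Δ Δ
placeH as-term          = hole
placeH (cut-head k u)   = cutH k u
placeH (sub-head m k u) = subH m k u

placeV : ∀ {Δ j Ξ} → ValPos Δ → VCtx Δ j Ξ → GCtx Δ Ξ
placeV as-term          V = val V
placeV (cut-head k u)   V = cutV V k u
placeV (sub-head m k u) V = subV m V k u

plug-placeH : ∀ {Δ j} (p : ValPos Δ) (w : Val Δ j) → plug (placeH p) (val w) ≡ place p w
plug-placeH as-term          w = refl
plug-placeH (cut-head k u)   w = cutL-val w k u
plug-placeH (sub-head m k u) w = cong (sub m w k) (renT-identity (liftR-identity (λ _ → refl)) u)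

emb-placeH : ∀ {Δ} (p : ValPos Δ) → emb (placeH p) ≗ʳ (λ x → x)
emb-placeH as-term          x = refl
emb-placeH (cut-head k u)   x = refl
emb-placeH (sub-head m k u) x = refl

plug-placeV : ∀ {Δ j Ξ} (p : ValPos Δ) (V : VCtx Δ j Ξ) (u : Tm Ξ) →
              plug (placeV p V) u ≡ place p (plugV V u)
plug-placeV as-term          V u = refl
plug-placeV (cut-head k t)   V u = refl
plug-placeV (sub-head m k t) V u = refl

emb-placeV : ∀ {Δ j Ξ} (p : ValPos Δ) (V : VCtx Δ j Ξ) → emb (placeV p V) ≗ʳ embV V
emb-placeV as-term          V x = refl
emb-placeV (cut-head k t)   V x = refl
emb-placeV (sub-head m k t) V x = refl

data VFrame (Δ : Ctx) : Kind → Ctx → Set where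
  pair₁ : Tm Δ → VFrame Δ 𝕞 Δ
  pair₂ : Tm Δ → VFrame Δ 𝕞 Δ
  lam   : (k : Kind) → VFrame Δ 𝕞 (k ∷ Δ)
  bang  : VFrame Δ 𝕖 Δ

vctx : ∀ {Δ j Δ₁ Ξ} → VFrame Δ j Δ₁ → GCtx Δ₁ Ξ → VCtx Δ j Ξ
vctx (pair₁ s) D = pairL D s
vctx (pair₂ t) D = pairR t D
vctx (lam k)   D = lam k D
vctx bang      D = bang D

embVF : ∀ {Δ j Δ₁} → VFrame Δ j Δ₁ → Ren Δ Δ₁
embVF (pair₁ s) x = x
embVF (pair₂ t) x = x
embVF (lam k)   x = there x
embVF bang      x = x

plugV-vctx : ∀ {Δ j Δ₁ Ξ} (F : VFrame Δ j Δ₁) (D : GCtx Δ₁ Ξ) (u : Tm Ξ) →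
             plugV (vctx F D) u ≡ plugV (vctx F hole) (plug D u)
plugV-vctx (pair₁ s) D u = refl
plugV-vctx (pair₂ t) D u = refl
plugV-vctx (lam k)   D u = refl
plugV-vctx bang      D u = refl

embV-vctx : ∀ {Δ j Δ₁ Ξ} (F : VFrame Δ j Δ₁) (D : GCtx Δ₁ Ξ) → embV (vctx F D) ≗ʳ (λ x → emb D (embVF F x))
embV-vctx (pair₁ s) D x = refl
embV-vctx (pair₂ t) D x = refl
embV-vctx (lam k)   D x = refl
embV-vctx bang      D x = refl

vframeF : ∀ {Δ j Δ₁} → ValPos Δ → VFrame Δ j Δ₁ → Frame Δ Δ₁
vframeF p F = record
  { fill      = λ D → placeV p (vctx F D)
  ; plug-fill = λ D u → begin
      plug (placeV p (vctx F D)) u                  ≡⟨ plug-placeV p (vctx F D) u ⟩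
      place p (plugV (vctx F D) u)                  ≡⟨ cong (place p) (plugV-vctx F D u) ⟩
      place p (plugV (vctx F hole) (plug D u))      ≡⟨ plug-placeV p (vctx F hole) (plug D u) ⟨
      plug (placeV p (vctx F hole)) (plug D u)      ∎
  ; emb-fill  = λ D x → begin
      emb (placeV p (vctx F D)) x                   ≡⟨ emb-placeV p (vctx F D) x ⟩
      embV (vctx F D) x                             ≡⟨ embV-vctx F D x ⟩
      emb D (embVF F x)                             ≡⟨ cong (emb D) (embV-vctx F hole x) ⟨
      emb D (embV (vctx F hole) x)                  ≡⟨ cong (emb D) (emb-placeV p (vctx F hole) x) ⟨
      emb D (emb (placeV p (vctx F hole)) x)        ∎
  }

vframeF-⟦⟧ : ∀ {Δ j Δ₁} (p : ValPos Δ) (F : VFrame Δ j Δ₁) (u : Tm Δ₁) →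
             vframeF p F ⟦ u ⟧ ≡ place p (plugV (vctx F hole) u)
vframeF-⟦⟧ p F = plug-placeV p (vctx F hole)

embF-vframeF : ∀ {Δ j Δ₁} (p : ValPos Δ) (F : VFrame Δ j Δ₁) → embF (vframeF p F) ≗ʳ embVF F
embF-vframeF p F x = trans (emb-placeV p (vctx F hole) x) (embV-vctx F hole x)

-- A subterm t : Tm Δ₀ of the body of cut(v_e, e.—) sits, in the body under a frame with hole
-- scope Δ, as renT ρ₀ t while unprocessed and as renT ρ (subTm σ t) once processed; E embeds the
-- scope of the cut (e and the outer Γ) into Δ, and τ embeds Γ into the scope Θ of subTm σ t.
-- Each variable of t either stands for e and is mapped by σ to v_e, or is left in place.
record Tracks {Γ Δ₀ Δ Θ : Ctx} (ve : Val Γ 𝕖) (E : Ren (𝕖 ∷ Γ) Δ) (ρ₀ : Ren Δ₀ Δ)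
              (σ : Sub Δ₀ Θ) (ρ : Ren Θ Δ) (τ : Ren Γ Θ) : Set where
  field
    outer : (λ y → ρ (τ y)) ≗ʳ (λ y → E (there y))
    mult  : (m : Δ₀ ∋ 𝕞) → ρ (σ m) ≡ ρ₀ m
    expo  : (x : Δ₀ ∋ 𝕖) →
            (ρ₀ x ≡ E here × σ x ≡ renV τ ve) ⊎ (∃[ y ] σ x ≡ evar y × ρ y ≡ ρ₀ x)
open Tracks

Tracks-single : ∀ {Γ} (ve : Val Γ 𝕖) → Tracks ve (λ x → x) (λ x → x) (single ve) there (λ x → x)
Tracks-single {Γ} ve = record { outer = λ _ → refl ; mult = mult-single ; expo = expo-single }
  where
  mult-single : (m : (𝕖 ∷ Γ) ∋ 𝕞) → there (single ve m) ≡ m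
  mult-single (there m) = refl
  expo-single : (x : (𝕖 ∷ Γ) ∋ 𝕖) →
                (x ≡ here × single ve x ≡ renV (λ y → y) ve)
                ⊎ (∃[ y ] single ve x ≡ evar y × there y ≡ x)
  expo-single here      = inj₁ (refl , sym (renV-id ve))
  expo-single (there x) = inj₂ (x , refl , refl)

Tracks-ren : ∀ {Γ Δ₀ Δ Δ₁ Θ} {ve : Val Γ 𝕖} {E : Ren (𝕖 ∷ Γ) Δ} {ρ₀ : Ren Δ₀ Δ} {σ : Sub Δ₀ Θ}
             {ρ : Ren Θ Δ} {τ : Ren Γ Θ} (φ : Ren Δ Δ₁) → Tracks ve E ρ₀ σ ρ τ →
             Tracks ve (λ x → φ (E x)) (λ x → φ (ρ₀ x)) σ (λ x → φ (ρ x)) τ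
Tracks-ren φ g = record
  { outer = λ y → cong φ (outer g y)
  ; mult  = λ m → cong φ (mult g m)
  ; expo  = λ x → Sum.map (λ (q , r) → cong φ q , r) (λ (y , q , r) → y , q , cong φ r) (expo g x)
  }

liftS-there : ∀ {Γ Θ} j (σ : Sub Γ Θ) {k} (x : Γ ∋ k) → liftS {j = j} σ (there x) ≡ wkImg k (σ x)
liftS-there 𝕞 σ x = refl
liftS-there 𝕖 σ x = refl

Tracks-lift : ∀ {Γ Δ₀ Δ Θ j} {ve : Val Γ 𝕖} {E : Ren (𝕖 ∷ Γ) Δ} {ρ₀ : Ren Δ₀ Δ} {σ : Sub Δ₀ Θ}
              {ρ : Ren Θ Δ} {τ : Ren Γ Θ} → Tracks ve E ρ₀ σ ρ τ →
              Tracks ve (λ x → there {j = j} (E x)) (liftR ρ₀) (liftS σ) (liftR ρ) (λ y → there (τ y))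
Tracks-lift {Δ₀ = Δ₀} {j = j} {ve} {E} {ρ₀} {σ} {ρ} {τ} g = record
  { outer = λ y → cong there (outer g y)
  ; mult  = mult-lift
  ; expo  = expo-lift
  }
  where
  mult-lift : (m : (j ∷ Δ₀) ∋ 𝕞) → liftR ρ (liftS σ m) ≡ liftR ρ₀ m
  mult-lift here = refl
  mult-lift (there m) rewrite liftS-there j σ m = cong there (mult g m)
  expo-lift : (x : (j ∷ Δ₀) ∋ 𝕖) →
              (liftR ρ₀ x ≡ there (E here) × liftS σ x ≡ renV (λ y → there (τ y)) ve)
              ⊎ (∃[ y ] liftS σ x ≡ evar y × liftR ρ y ≡ liftR ρ₀ x)
  expo-lift here = inj₂ (here , refl , refl)
  expo-lift (there x) rewrite liftS-there j σ x with expo g x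
  ... | inj₁ (q , r)     = inj₁ (cong there q , trans (cong (renV there) r) (renV-fusion (λ _ → refl) ve))
  ... | inj₂ (y , q , r) = inj₂ (there y , cong (renV there) q , cong there r)

module Sweep {Γ₀ Γ : Ctx} (C₀ : GCtx Γ₀ Γ) where

  infix 4 _⇒*[_]_

  _⇒*[_]_ : Tm (𝕖 ∷ Γ) → Val Γ 𝕖 → Tm (𝕖 ∷ Γ) → Set
  t ⇒*[ ve ] s = Star _→ems_ (plug C₀ (cut ve 𝕖 t)) (plug C₀ (cut ve 𝕖 s))

  step : ∀ {ve t s t′ s′} → t ≡ t′ → s ≡ s′ →
         plug C₀ (cut ve 𝕖 t) →ems plug C₀ (cut ve 𝕖 s) → t′ ⇒*[ ve ] s′
  step refl refl r = r ◅ ε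

  descend : ∀ {ve Δ Δ₁} (K : Frame (𝕖 ∷ Γ) Δ) (F : Frame Δ Δ₁) {A B : Tm Δ₁} →
            (K ∘F F) ⟦ A ⟧ ⇒*[ ve ] (K ∘F F) ⟦ B ⟧ → K ⟦ F ⟦ A ⟧ ⟧ ⇒*[ ve ] K ⟦ F ⟦ B ⟧ ⟧
  descend {ve} K F = subst₂ _⇒*[ ve ]_ (⟦⟧-∘F K F _) (⟦⟧-∘F K F _)

  descendL : ∀ {ve Δ Δ₁} (K : Frame (𝕖 ∷ Γ) Δ) (L : LCtx Δ Δ₁) {A B : Tm Δ₁} →
             (K ∘F lctxF L) ⟦ A ⟧ ⇒*[ ve ] (K ∘F lctxF L) ⟦ B ⟧ →
             K ⟦ plugL L A ⟧ ⇒*[ ve ] K ⟦ plugL L B ⟧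
  descendL {ve} K L r =
    subst₂ _⇒*[ ve ]_ (cong (K ⟦_⟧) (lctxF-⟦⟧ L _)) (cong (K ⟦_⟧) (lctxF-⟦⟧ L _))
           (descend K (lctxF L) r)

  descendV : ∀ {ve Δ j Δ₁} (K : Frame (𝕖 ∷ Γ) Δ) (p : ValPos Δ) (F : VFrame Δ j Δ₁) {A B : Tm Δ₁} →
             (K ∘F vframeF p F) ⟦ A ⟧ ⇒*[ ve ] (K ∘F vframeF p F) ⟦ B ⟧ →
             K ⟦ place p (plugV (vctx F hole) A) ⟧ ⇒*[ ve ] K ⟦ place p (plugV (vctx F hole) B) ⟧
  descendV {ve} K p F r =
    subst₂ _⇒*[ ve ]_ (cong (K ⟦_⟧) (vframeF-⟦⟧ p F _)) (cong (K ⟦_⟧) (vframeF-⟦⟧ p F _))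
           (descend K (vframeF p F) r)

  embF-extend : ∀ {Δ Δ₁} (K : Frame (𝕖 ∷ Γ) Δ) {E : Ren (𝕖 ∷ Γ) Δ} → embF K ≗ʳ E →
                (F : Frame Δ Δ₁) {φ : Ren Δ Δ₁} → embF F ≗ʳ φ → embF (K ∘F F) ≗ʳ (λ x → φ (E x))
  embF-extend K {E} eE F {φ} eF x = trans (embF-∘F K F x) (trans (eF (embF K x)) (cong φ (eE x)))

  replace-evar : ∀ {Δ Θ} (ve : Val Γ 𝕖) (p : ValPos Δ) (K : Frame (𝕖 ∷ Γ) Δ) {E : Ren (𝕖 ∷ Γ) Δ}
                 {ρ : Ren Θ Δ} {τ : Ren Γ Θ} → embF K ≗ʳ E → (λ y → ρ (τ y)) ≗ʳ (λ y → E (there y)) →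
                 K ⟦ place p (evar (E here)) ⟧ ⇒*[ ve ] K ⟦ place p (renV ρ (renV τ ve)) ⟧
  replace-evar ve p K {E} eE outer =
    step (trans (plug-C (evar (emb C here))) (cong (λ e → K ⟦ place p (evar e) ⟧) (emb-C here)))
         (trans (plug-C _) (cong (λ w → K ⟦ place p w ⟧)
                                 (renV-square (λ y → trans (emb-C (there y)) (sym (outer y))) ve)))
         (inj₁ (ctx C₀ (axe1 ve C)))
    where
    C = fill K (placeH p)
    plug-C : ∀ {j} (w : Val _ j) → plug C (val w) ≡ K ⟦ place p w ⟧
    plug-C w = trans (plug-fill K (placeH p) (val w)) (cong (K ⟦_⟧) (plug-placeH p w))
    emb-C : emb C ≗ʳ E
    emb-C x = trans (emb-fill K (placeH p) x) (trans (emb-placeH p (embF K x)) (eE x))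

  mutual
    process-tm : ∀ {Δ₀ Δ Θ} (ve : Val Γ 𝕖) (t : Tm Δ₀) (K : Frame (𝕖 ∷ Γ) Δ) {E : Ren (𝕖 ∷ Γ) Δ}
                 {ρ₀ : Ren Δ₀ Δ} {σ : Sub Δ₀ Θ} {ρ : Ren Θ Δ} {τ : Ren Γ Θ} →
                 embF K ≗ʳ E → Tracks ve E ρ₀ σ ρ τ →
                 K ⟦ renT ρ₀ t ⟧ ⇒*[ ve ] K ⟦ renT ρ (subTm σ t) ⟧
    process-tm ve (val v) K eE g = process-val ve v as-term K eE g
    process-tm ve (cut v k t) K {ρ₀ = ρ₀} {σ} {ρ} eE g =
      process-val ve v (cut-head k (renT (liftR ρ₀) t)) K eE g
      ◅◅ descendL K L (process-in ve t K (lctxF L) (λ _ → refl) eE (Tracks-lift g))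
      where
      L = cut (renV ρ (subVal σ v)) k hole
    process-tm ve (par m k₁ k₂ t) K {ρ₀ = ρ₀} eE g rewrite mult g m =
      descendL K L
        (process-in ve t K (lctxF L) (λ _ → refl) eE (Tracks-lift (Tracks-lift g)))
      where
      L = par (ρ₀ m) k₁ k₂ hole
    process-tm ve (sub m v k t) K {ρ₀ = ρ₀} {σ} {ρ} eE g rewrite mult g m =
      process-val ve v (sub-head (ρ₀ m) k (renT (liftR ρ₀) t)) K eE g
      ◅◅ descendL K L (process-in ve t K (lctxF L) (λ _ → refl) eE (Tracks-lift g))
      where
      L = sub (ρ₀ m) (renV ρ (subVal σ v)) k hole
    process-tm ve (der x k t) K {ρ₀ = ρ₀} eE g with expo g x
    ... | inj₁ (ρ₀x≡e , σx≡ve) rewrite ρ₀x≡e | σx≡ve = process-der ve t K eE g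
    ... | inj₂ (y , σx≡y , ρy≡ρ₀x) rewrite σx≡y | ρy≡ρ₀x =
      descendL K L (process-in ve t K (lctxF L) (λ _ → refl) eE (Tracks-lift g))
      where
      L = der (ρ₀ x) k hole

    process-in : ∀ {Δ₀ Δ Δ₁ Θ} (ve : Val Γ 𝕖) (t : Tm Δ₀) (K : Frame (𝕖 ∷ Γ) Δ) (F : Frame Δ Δ₁)
                 {φ : Ren Δ Δ₁} {E : Ren (𝕖 ∷ Γ) Δ} {ρ₀ : Ren Δ₀ Δ₁} {σ : Sub Δ₀ Θ} {ρ : Ren Θ Δ₁}
                 {τ : Ren Γ Θ} → embF F ≗ʳ φ → embF K ≗ʳ E → Tracks ve (λ x → φ (E x)) ρ₀ σ ρ τ →
                 (K ∘F F) ⟦ renT ρ₀ t ⟧ ⇒*[ ve ] (K ∘F F) ⟦ renT ρ (subTm σ t) ⟧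
    process-in ve t K F eF eE = process-tm ve t (K ∘F F) (embF-extend K eE F eF)

    process-val : ∀ {Δ₀ Δ Θ j} (ve : Val Γ 𝕖) (v : Val Δ₀ j) (p : ValPos Δ) (K : Frame (𝕖 ∷ Γ) Δ)
                  {E : Ren (𝕖 ∷ Γ) Δ} {ρ₀ : Ren Δ₀ Δ} {σ : Sub Δ₀ Θ} {ρ : Ren Θ Δ} {τ : Ren Γ Θ} →
                  embF K ≗ʳ E → Tracks ve E ρ₀ σ ρ τ →
                  K ⟦ place p (renV ρ₀ v) ⟧ ⇒*[ ve ] K ⟦ place p (renV ρ (subVal σ v)) ⟧
    process-val ve (mvar m) p K eE g rewrite mult g m = ε
    process-val ve (evar x) p K eE g with expo g x
    ... | inj₁ (ρ₀x≡e , σx≡ve) rewrite ρ₀x≡e | σx≡ve = replace-evar ve p K eE (outer g)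
    ... | inj₂ (y , σx≡y , ρy≡ρ₀x) rewrite σx≡y | ρy≡ρ₀x = ε
    process-val ve (pair t s) p K {ρ₀ = ρ₀} {σ} {ρ} eE g =
      descendV K p F₁ (process-in ve t K (vframeF p F₁) (embF-vframeF p F₁) eE g)
      ◅◅ descendV K p F₂ (process-in ve s K (vframeF p F₂) (embF-vframeF p F₂) eE g)
      where
      F₁ = pair₁ (renT ρ₀ s)
      F₂ = pair₂ (renT ρ (subTm σ t))
    process-val ve (lam k t) p K eE g =
      descendV K p (lam k)
        (process-in ve t K (vframeF p (lam k)) (embF-vframeF p (lam k)) eE (Tracks-lift g))
    process-val ve (bang t) p K eE g =
      descendV K p bang (process-in ve t K (vframeF p bang) (embF-vframeF p bang) eE g)

    process-der : ∀ {Δ₀ Δ Θ k} (ve : Val Γ 𝕖) (t : Tm (k ∷ Δ₀)) (K : Frame (𝕖 ∷ Γ) Δ)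
                  {E : Ren (𝕖 ∷ Γ) Δ} {ρ₀ : Ren Δ₀ Δ} {σ : Sub Δ₀ Θ} {ρ : Ren Θ Δ} {τ : Ren Γ Θ} →
                  embF K ≗ʳ E → Tracks ve E ρ₀ σ ρ τ →
                  K ⟦ der (E here) k (renT (liftR ρ₀) t) ⟧
                    ⇒*[ ve ] K ⟦ renT ρ (derS (renV τ ve) k (subTm (liftS σ) t)) ⟧
    process-der {k = k} (evar f) t K {E} {ρ₀} {σ} {ρ} {τ} eE g =
      step (cong (λ e → K ⟦ der e k A ⟧) (eE here))
           (cong (λ e → K ⟦ der e k A ⟧) (trans (eE (there f)) (sym (outer g f))))
           (inj₂ (inj₁ (ctx C₀ (axe2 f (fill K hole) k A))))
      ◅◅ descendL K L (process-in (evar f) t K (lctxF L) (λ _ → refl) eE (Tracks-lift g))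
      where
      A = renT (liftR ρ₀) t
      L = der (ρ (τ f)) k hole
    process-der {k = k} (bang s) t K {E} {ρ₀} {σ} {ρ} {τ} eE g =
      step (cong (λ e → K ⟦ der e k A ⟧) (eE here))
           (cong (λ s′ → K ⟦ cutL s′ k A ⟧) (renT-cong (λ y → eE (there y)) s))
           (inj₂ (inj₂ (inj₁ (ctx C₀ (bangder s (fill K hole) k A)))))
      ◅◅ subst₂ _⇒*[ bang s ]_ (cong (K ⟦_⟧) (sym (cutL-renT S k ρ₀ t))) (cong (K ⟦_⟧) (sym unfold-B))
           (descendL K L (descendL (K ∘F lctxF L) (cut v k hole)
             (process-in (bang s) t (K ∘F lctxF L) (lctxF (cut v k hole)) (λ _ → refl)
                         (embF-extend K eE (lctxF L) (embF-lctxF L))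
                         (Tracks-lift (Tracks-ren (embL L) g)))))
      where
      A = renT (liftR ρ₀) t
      U = subTm (liftS σ) t
      S = renT (λ y → E (there y)) s
      L = lctx (decomp S)
      v = value (decomp S)
      unfold-B : renT ρ (cutL (renT τ s) k U) ≡ plugL L (cut v k (renT (liftR (λ x → embL L (ρ x))) U))
      unfold-B = begin
        renT ρ (cutL (renT τ s) k U)                   ≡⟨ renT-cutL ρ (renT τ s) k U ⟩
        cutL (renT ρ (renT τ s)) k (renT (liftR ρ) U)  ≡⟨ cong (λ s′ → cutL s′ k (renT (liftR ρ) U))
                                                               (renT-fusion (outer g) s) ⟩
        cutL S k (renT (liftR ρ) U)                    ≡⟨ cutL-renT S k ρ U ⟩
        plugL L (cut v k (renT (liftR (λ x → embL L (ρ x))) U)) ∎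

star-snoc⁺ : ∀ {A : Set} {R : A → A → Set} {a b c : A} → Star R a b → R b c → TransClosure R a c
star-snoc⁺ ε       r = [ r ]
star-snoc⁺ (q ◅ qs) r = q ∷ star-snoc⁺ qs r

proposition7p1 : ∀ {Γ : Ctx} {t s : Tm Γ} → t →ess s → t →ems⁺ s
proposition7p1 (ctx C (ess ve t)) = star-snoc⁺ sweep erase
  where
  open Sweep C
  sweep : t ⇒*[ ve ] renT wk (t [ ve /e])
  sweep = subst (_⇒*[ ve ] renT wk (t [ ve /e])) (renT-id t)
                (process-tm ve t idF (λ _ → refl) (Tracks-single ve))
  erase : plug C (cut ve 𝕖 (renT wk (t [ ve /e]))) →ems plug C (t [ ve /e])
  erase = inj₂ (inj₂ (inj₂ (ctx C (weak ve (t [ ve /e])))))
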